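{- Let $\Sigma$ be a finite vocabulary including the property name $r$, let $m$ be a natural number, let $G'=G'_{\mathit{disj}}(\Sigma,m)$, and let $E$ be a non-simple, $\mathit{id}$-free path expression over $\Sigma$. Then: (1) $[\![E]\!]^{G'}\supseteq[\![r]\!]^{G'}$ or $[\![E]\!]^{G'}\supseteq[\![r^-]\!]^{G'}$; (2) for all nodes $v$ of $G'$, $[\![E]\!]^{G'}(v)\setminus[\![r]\!]^{G'}(v)\neq\emptyset$.
   Context: Fix two disjoint infinite sets $N$ (node names) and $P$ (property names). Path expressions: $E ::= \mathit{id} \mid p \mid p^- \mid E\cup E \mid E\circ E \mid E^*$, $p\in P$; $\mathit{id}$-free means $\mathit{id}$ does not occur; $E$ is over $\Sigma\subseteq N\cup P$ if all its property names lie in $\Sigma$. A path expression is simple if it is a union of expressions of the form $s_1\circ\dots\circ s_n$ with $n\ge1$, where one of the $s_i$ is a property name and all others are $\mathit{id}$. A graph is a finite set of triples $(a,p,b)$, $a,b\in N$, $p\in P$. Semantics (domain $N$): $[\![p]\!]^G=\{(a,b):(a,p,b)\in G\}$, $\mathit{id}$ identity on $N$, $p^-$ inverse, $\cup$ union, $\circ$ composition, $E^*$ reflexive-transitive closure on $N$; $R(x)=\{y:(x,y)\in R\}$. Graph $G'_{\mathit{disj}}(\Sigma,m)$: let $M=\max(m,3)$ and take $4M$ distinct node names $x_i^j$ ($i\in\{1,2,3,4\}$, $j\in\{1,\dots,M\}$) not in $\Sigma$; for each property name $p\in\Sigma\cap P$ it contains $(x_i^j,p,x_{i\bmod4+1}^{j'})$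 for all $i,j,j'$ and $(x_i^j,p,x_i^{j'})$ for all $i$ and all $j\neq j'$, and nothing else. -}

module Defs where

open import Data.Nat using (ℕ; _⊔_)
open import Data.Fin using (Fin; zero; suc)
open import Data.Sum using (_⊎_; inj₁; inj₂)
open import Data.Product using (_×_; ∃; ∃-syntax; _,_)
open import Data.List using (List)
open import Data.List.Membership.Propositional using (_∈_; _∉_)
open import Relation.Binary.PropositionalEquality using (_≡_; _≢_)
open import Relation.Binary.Construct.Closure.ReflexiveTransitive using (Star)

-- Node names N and property names P: two disjoint infinite sets,
-- modelled as two separate copies of ℕ.
NodeName : Set
NodeName = ℕ

PropName : Set
PropName = ℕ

Vocabulary : Set
Vocabulary = List (NodeName ⊎ PropName)

data PathExpr : Set where
  idE  : PathExpr
  prop : PropName → PathExpr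
  inv  : PropName → PathExpr
  _∪E_ : PathExpr → PathExpr → PathExpr
  _∘E_ : PathExpr → PathExpr → PathExpr
  star : PathExpr → PathExpr

data IdFree : PathExpr → Set where
  prop-f  : ∀ p → IdFree (prop p)
  inv-f   : ∀ p → IdFree (inv p)
  union-f : ∀ {E F} → IdFree E → IdFree F → IdFree (E ∪E F)
  comp-f  : ∀ {E F} → IdFree E → IdFree F → IdFree (E ∘E F)
  star-f  : ∀ {E} → IdFree E → IdFree (star E)

data Over (Σ : Vocabulary) : PathExpr → Set where
  id-o    : Over Σ idE
  prop-o  : ∀ {p} → inj₂ p ∈ Σ → Over Σ (prop p)
  inv-o   : ∀ {p} → inj₂ p ∈ Σ → Over Σ (inv p)
  union-o : ∀ {E F} → Over Σ E → Over Σ F → Over Σ (E ∪E F)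
  comp-o  : ∀ {E F} → Over Σ E → Over Σ F → Over Σ (E ∘E F)
  star-o  : ∀ {E} → Over Σ E → Over Σ (star E)

data IdChain : PathExpr → Set where
  id-c   : IdChain idE
  comp-c : ∀ {E F} → IdChain E → IdChain F → IdChain (E ∘E F)

-- s₁ ∘ … ∘ sₙ (n ≥ 1, any parenthesisation) where exactly one sᵢ is a
-- property name and all others are id
data OnePropChain : PathExpr → Set where
  prop-c  : ∀ p → OnePropChain (prop p)
  left-c  : ∀ {E F} → OnePropChain E → IdChain F → OnePropChain (E ∘E F)
  right-c : ∀ {E F} → IdChain E → OnePropChain F → OnePropChain (E ∘E F)

data Simple : PathExpr → Set where
  chain-s : ∀ {E} → OnePropChain E → Simple E
  union-s : ∀ {E F} → Simple E → Simple F → Simple (E ∪E F)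

-- A graph, given as its set of triples (a, p, b) (membership predicate)
Graph : Set₁
Graph = NodeName → PropName → NodeName → Set

⟦_⟧ : PathExpr → Graph → NodeName → NodeName → Set
⟦ idE ⟧    G a b = a ≡ b
⟦ prop p ⟧ G a b = G a p b
⟦ inv p ⟧  G a b = G b p a
⟦ E ∪E F ⟧ G a b = ⟦ E ⟧ G a b ⊎ ⟦ F ⟧ G a b
⟦ E ∘E F ⟧ G a b = ∃[ c ] (⟦ E ⟧ G a c × ⟦ F ⟧ G c b)
⟦ star E ⟧ G a b = Star (⟦ E ⟧ G) a b

NodeOf : Graph → NodeName → Set
NodeOf G v = (∃[ p ] ∃[ b ] G v p b) ⊎ (∃[ a ] ∃[ p ] G a p v)

-- i ↦ i mod 4 + 1 on indices {1,2,3,4}, here encoded as Fin 4 = {0,1,2,3}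
next4 : Fin 4 → Fin 4
next4 zero = suc zero
next4 (suc zero) = suc (suc zero)
next4 (suc (suc zero)) = suc (suc (suc zero))
next4 (suc (suc (suc zero))) = zero

bigM : ℕ → ℕ
bigM m = m ⊔ 3

record NameChoice (Σ : Vocabulary) (m : ℕ) : Set where
  field
    x        : Fin 4 → Fin (bigM m) → NodeName
    distinct : ∀ i j i' j' → x i j ≡ x i' j' → (i ≡ i') × (j ≡ j')
    fresh    : ∀ i j → inj₁ (x i j) ∉ Σ

G'disj : (Σ : Vocabulary) (m : ℕ) → NameChoice Σ m → Graph
G'disj Σ m c a p b =
  inj₂ p ∈ Σ ×
  ( (∃[ i ] ∃[ j ] ∃[ j' ] (a ≡ x i j × b ≡ x (next4 i) j'))
  ⊎ (∃[ i ] ∃[ j ] ∃[ j' ] (j ≢ j' × a ≡ x i j × b ≡ x i j')) )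
  where open NameChoice c

{-# OPTIONS --safe #-}
-- Every Σ-property of G'disj is the same relation R, an irreflexive relation
-- in which every edge factors as R;R, R;R˘ and R˘;R.  Hence, by induction on
-- E, the semantics of an id-free E contains R or R˘.  A non-simple id-free
-- expression must contain an inverse, a star or a composition, and each of
-- these leads out of the r-successors of a node: an inverse goes back one
-- block, a star stays put, and a composition of two R/R˘ steps either returns
-- to the start or moves two blocks around the 4-cycle.
module Submission where

open import Defs
open import Level using (0ℓ)
open import Data.Nat using (ℕ; _≤_; s≤s)
open import Data.Nat.Properties using (m≤n⊔m)
open import Data.Fin using (Fin; zero; suc)
open import Data.Sum as Sum using (_⊎_; inj₁; inj₂)
open import Data.Product using (_×_; ∃-syntax; _,_)
open import Data.List.Membership.Propositional using (_∈_)
open import Function using (flip)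
open import Relation.Nullary using (¬_; Dec; yes; no; contradiction)
open import Relation.Binary.Core using (Rel; _⇒_)
open import Relation.Binary.PropositionalEquality using (_≡_; _≢_; refl; sym; subst; ≢-sym)
open import Relation.Binary.Construct.Closure.ReflexiveTransitive using (ε; _◅_)

private
  variable
    E F : PathExpr

IdChain⇒¬IdFree : IdChain E → ¬ IdFree E
IdChain⇒¬IdFree id-c ()
IdChain⇒¬IdFree (comp-c c _) (comp-f f _) = IdChain⇒¬IdFree c f

simple? : IdFree E → Dec (Simple E)
simple? (prop-f p) = yes (chain-s (prop-c p))
simple? (inv-f p) = no λ { (chain-s ()) }
simple? (star-f _) = no λ { (chain-s ()) }
simple? (comp-f f g) = no λ
  { (chain-s (left-c _ c))  → IdChain⇒¬IdFree c g
  ; (chain-s (right-c c _)) → IdChain⇒¬IdFree c f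
  }
simple? (union-f f g) with simple? f | simple? g
... | yes s | yes t = yes (union-s s t)
... | no ¬s | _     = no λ { (union-s s _) → ¬s s ; (chain-s ()) }
... | _     | no ¬t = no λ { (union-s _ t) → ¬t t ; (chain-s ()) }

¬Simple-∪ : IdFree E → ¬ Simple (E ∪E F) → ¬ Simple E ⊎ ¬ Simple F
¬Simple-∪ f ¬s with simple? f
... | yes s = inj₂ λ t → ¬s (union-s s t)
... | no ¬s' = inj₁ ¬s'

record Factorising (R : Rel NodeName 0ℓ) : Set where
  field
    R⇒R∘R  : ∀ {a b} → R a b → ∃[ w ] (R a w × R w b)
    R⇒R∘R˘ : ∀ {a b} → R a b → ∃[ w ] (R a w × R b w)
    R⇒R˘∘R : ∀ {a b} → R a b → ∃[ w ] (R w a × R w b)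

record NonSuccessorWitnesses (R : Rel NodeName 0ℓ) (v : NodeName) : Set where
  field
    irreflexive  : ¬ R v v
    successor    : ∃[ w ] R v w
    predecessor  : ∃[ y ] (R y v × ¬ R v y)
    forward²     : ∃[ w ] ∃[ y ] (R v w × R w y × ¬ R v y)
    backward²    : ∃[ w ] ∃[ y ] (R w v × R y w × ¬ R v y)

open NonSuccessorWitnesses

module _ {G : Graph} {Σ : Vocabulary} {R : Rel NodeName 0ℓ}
         (R⇒prop : ∀ {p} → inj₂ p ∈ Σ → R ⇒ ⟦ prop p ⟧ G)
         (factorising : Factorising R) where
  open Factorising factorising

  ⟦⟧-⊇-or-⊇˘ : IdFree E → Over Σ E → R ⇒ ⟦ E ⟧ G ⊎ flip R ⇒ ⟦ E ⟧ G
  ⟦⟧-⊇-or-⊇˘ (prop-f p) (prop-o pΣ) = inj₁ (R⇒prop pΣ)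
  ⟦⟧-⊇-or-⊇˘ (inv-f p) (inv-o pΣ) = inj₂ (R⇒prop pΣ)
  ⟦⟧-⊇-or-⊇˘ (union-f f _) (union-o o _) =
    Sum.map (λ h x → inj₁ (h x)) (λ h x → inj₁ (h x)) (⟦⟧-⊇-or-⊇˘ f o)
  ⟦⟧-⊇-or-⊇˘ (star-f f) (star-o o) =
    Sum.map (λ h x → h x ◅ ε) (λ h x → h x ◅ ε) (⟦⟧-⊇-or-⊇˘ f o)
  ⟦⟧-⊇-or-⊇˘ (comp-f f g) (comp-o o o') with ⟦⟧-⊇-or-⊇˘ f o | ⟦⟧-⊇-or-⊇˘ g o'
  ... | inj₁ h | inj₁ k = inj₁ λ x → let w , p , q = R⇒R∘R x  in w , h p , k q
  ... | inj₁ h | inj₂ k = inj₁ λ x → let w , p , q = R⇒R∘R˘ x in w , h p , k q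
  ... | inj₂ h | inj₁ k = inj₁ λ x → let w , p , q = R⇒R˘∘R x in w , h p , k q
  ... | inj₂ h | inj₂ k = inj₂ λ x → let w , p , q = R⇒R∘R x  in w , h q , k p

  ⟦⟧-leaves-R : ¬ Simple E → IdFree E → Over Σ E → ∀ {v} → NonSuccessorWitnesses R v →
                ∃[ y ] (⟦ E ⟧ G v y × ¬ R v y)
  ⟦⟧-leaves-R ¬s (prop-f p) _ _ = contradiction (chain-s (prop-c p)) ¬s
  ⟦⟧-leaves-R _ (inv-f p) (inv-o pΣ) ws =
    let y , yRv , ¬vRy = predecessor ws in y , R⇒prop pΣ yRv , ¬vRy
  ⟦⟧-leaves-R _ (star-f _) _ {v} ws = v , ε , irreflexive ws
  ⟦⟧-leaves-R _ (comp-f f g) (comp-o o o') {v} ws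
    with ⟦⟧-⊇-or-⊇˘ f o | ⟦⟧-⊇-or-⊇˘ g o'
  ... | inj₁ h | inj₁ k = let w , y , p , q , ¬vRy = forward² ws  in y , (w , h p , k q) , ¬vRy
  ... | inj₂ h | inj₂ k = let w , y , p , q , ¬vRy = backward² ws in y , (w , h p , k q) , ¬vRy
  ... | inj₁ h | inj₂ k = let w , p = successor ws in v , (w , h p , k p) , irreflexive ws
  ... | inj₂ h | inj₁ k = let u , p , _ = predecessor ws in v , (u , h p , k p) , irreflexive ws
  ⟦⟧-leaves-R ¬s (union-f f g) (union-o o o') ws with ¬Simple-∪ f ¬s
  ... | inj₁ ¬sE = let y , e , n = ⟦⟧-leaves-R ¬sE f o ws in y , inj₁ e , n
  ... | inj₂ ¬sF = let y , e , n = ⟦⟧-leaves-R ¬sF g o' ws in y , inj₂ e , n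

prev4 : Fin 4 → Fin 4
prev4 zero = suc (suc (suc zero))
prev4 (suc zero) = zero
prev4 (suc (suc zero)) = suc zero
prev4 (suc (suc (suc zero))) = suc (suc zero)

next4-prev4 : ∀ i → next4 (prev4 i) ≡ i
next4-prev4 zero = refl
next4-prev4 (suc zero) = refl
next4-prev4 (suc (suc zero)) = refl
next4-prev4 (suc (suc (suc zero))) = refl

-- No edge of G'disj leads from block i to block i'.
Distant : Fin 4 → Fin 4 → Set
Distant i i' = i' ≢ i × i' ≢ next4 i

distant-prev4 : ∀ i → Distant i (prev4 i)
distant-prev4 zero = (λ ()) , (λ ())
distant-prev4 (suc zero) = (λ ()) , (λ ())
distant-prev4 (suc (suc zero)) = (λ ()) , (λ ())
distant-prev4 (suc (suc (suc zero))) = (λ ()) , (λ ())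

distant-next4² : ∀ i → Distant i (next4 (next4 i))
distant-next4² zero = (λ ()) , (λ ())
distant-next4² (suc zero) = (λ ()) , (λ ())
distant-next4² (suc (suc zero)) = (λ ()) , (λ ())
distant-next4² (suc (suc (suc zero))) = (λ ()) , (λ ())

distant-prev4² : ∀ i → Distant i (prev4 (prev4 i))
distant-prev4² zero = (λ ()) , (λ ())
distant-prev4² (suc zero) = (λ ()) , (λ ())
distant-prev4² (suc (suc zero)) = (λ ()) , (λ ())
distant-prev4² (suc (suc (suc zero))) = (λ ()) , (λ ())

next4-irreflexive : ∀ i → next4 i ≢ i
next4-irreflexive zero = λ ()
next4-irreflexive (suc zero) = λ ()
next4-irreflexive (suc (suc zero)) = λ ()
next4-irreflexive (suc (suc (suc zero))) = λ ()

avoid₂ : ∀ {n} → 3 ≤ n → (j j' : Fin n) → ∃[ k ] (k ≢ j × k ≢ j')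
avoid₂ (s≤s (s≤s (s≤s _))) (suc _) (suc _) = zero , (λ ()) , (λ ())
avoid₂ (s≤s (s≤s (s≤s _))) zero zero = suc zero , (λ ()) , (λ ())
avoid₂ (s≤s (s≤s (s≤s _))) zero (suc zero) = suc (suc zero) , (λ ()) , (λ ())
avoid₂ (s≤s (s≤s (s≤s _))) zero (suc (suc _)) = suc zero , (λ ()) , (λ ())
avoid₂ (s≤s (s≤s (s≤s _))) (suc zero) zero = suc (suc zero) , (λ ()) , (λ ())
avoid₂ (s≤s (s≤s (s≤s _))) (suc (suc _)) zero = suc zero , (λ ()) , (λ ())

module G'disjProperties (Σ : Vocabulary) (r : PropName) (rΣ : inj₂ r ∈ Σ)
                        (m : ℕ) (c : NameChoice Σ m) where
  open NameChoice c

  G : Graph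
  G = G'disj Σ m c

  R : Rel NodeName 0ℓ
  R = ⟦ prop r ⟧ G

  R⇒prop : ∀ {p} → inj₂ p ∈ Σ → R ⇒ ⟦ prop p ⟧ G
  R⇒prop pΣ (_ , e) = pΣ , e

  R-next : ∀ i j j' → R (x i j) (x (next4 i) j')
  R-next i j j' = rΣ , inj₁ (i , j , j' , refl , refl)

  R-prev : ∀ i j j' → R (x (prev4 i) j') (x i j)
  R-prev i j j' = subst (λ i' → R (x (prev4 i) j') (x i' j)) (next4-prev4 i) (R-next (prev4 i) j' j)

  R-within : ∀ i {j j'} → j ≢ j' → R (x i j) (x i j')
  R-within i {j} {j'} j≢j' = rΣ , inj₂ (i , j , j' , j≢j' , refl , refl)

  R-inversion : ∀ {i j i' j'} → R (x i j) (x i' j') → i' ≡ next4 i ⊎ (i' ≡ i × j ≢ j')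
  R-inversion (_ , inj₁ (_ , _ , _ , e , e'))
    with distinct _ _ _ _ e | distinct _ _ _ _ e'
  ... | refl , refl | refl , refl = inj₁ refl
  R-inversion (_ , inj₂ (_ , _ , _ , j≢j' , e , e'))
    with distinct _ _ _ _ e | distinct _ _ _ _ e'
  ... | refl , refl | refl , refl = inj₂ (refl , j≢j')

  ¬R-distant : ∀ {i j i' j'} → Distant i i' → ¬ R (x i j) (x i' j')
  ¬R-distant (i'≢i , i'≢next) e with R-inversion e
  ... | inj₁ i'≡next = i'≢next i'≡next
  ... | inj₂ (i'≡i , _) = i'≢i i'≡i

  ¬R-loop : ∀ i j → ¬ R (x i j) (x i j)
  ¬R-loop i j e with R-inversion e
  ... | inj₁ i≡next = next4-irreflexive i (sym i≡next)
  ... | inj₂ (_ , j≢j) = j≢j refl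

  other-index : (j j' : Fin (bigM m)) → ∃[ k ] (k ≢ j × k ≢ j')
  other-index = avoid₂ (m≤n⊔m m 3)

  factorising : Factorising R
  factorising = record { R⇒R∘R = R⇒R∘R ; R⇒R∘R˘ = R⇒R∘R˘ ; R⇒R˘∘R = R⇒R˘∘R }
    where
    R⇒R∘R : ∀ {a b} → R a b → ∃[ w ] (R a w × R w b)
    R⇒R∘R (_ , inj₁ (i , j , j' , refl , refl)) =
      let k , k≢j , _ = other-index j j in x i k , R-within i (≢-sym k≢j) , R-next i k j'
    R⇒R∘R (_ , inj₂ (i , j , j' , j≢j' , refl , refl)) =
      let k , k≢j , k≢j' = other-index j j' in x i k , R-within i (≢-sym k≢j) , R-within i k≢j'

    R⇒R∘R˘ : ∀ {a b} → R a b → ∃[ w ] (R a w × R b w)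
    R⇒R∘R˘ (_ , inj₁ (i , j , j' , refl , refl)) =
      let k , k≢j' , _ = other-index j' j' in x (next4 i) k , R-next i j k , R-within (next4 i) (≢-sym k≢j')
    R⇒R∘R˘ (_ , inj₂ (i , j , j' , _ , refl , refl)) = x (next4 i) j , R-next i j j , R-next i j' j

    R⇒R˘∘R : ∀ {a b} → R a b → ∃[ w ] (R w a × R w b)
    R⇒R˘∘R (_ , inj₁ (i , j , j' , refl , refl)) =
      let k , k≢j , _ = other-index j j in x i k , R-within i k≢j , R-next i k j'
    R⇒R˘∘R (_ , inj₂ (i , j , j' , _ , refl , refl)) =
      let k , k≢j , k≢j' = other-index j j' in x i k , R-within i k≢j , R-within i k≢j'

  nonSuccessorWitnesses : ∀ i j → NonSuccessorWitnesses R (x i j)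
  nonSuccessorWitnesses i j = record
    { irreflexive = ¬R-loop i j
    ; successor   = x (next4 i) j , R-next i j j
    ; predecessor = x (prev4 i) j , R-prev i j j , ¬R-distant (distant-prev4 i)
    ; forward²    = x (next4 i) j , x (next4 (next4 i)) j
                  , R-next i j j , R-next (next4 i) j j , ¬R-distant (distant-next4² i)
    ; backward²   = x (prev4 i) j , x (prev4 (prev4 i)) j
                  , R-prev i j j , R-prev (prev4 i) j j , ¬R-distant (distant-prev4² i)
    }

  node-name : ∀ {v} → NodeOf G v → ∃[ i ] ∃[ j ] (v ≡ x i j)
  node-name (inj₁ (_ , _ , _ , inj₁ (i , j , _ , e , _)))     = i , j , e
  node-name (inj₁ (_ , _ , _ , inj₂ (i , j , _ , _ , e , _))) = i , j , e
  node-name (inj₂ (_ , _ , _ , inj₁ (i , _ , j' , _ , e)))     = next4 i , j' , e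
  node-name (inj₂ (_ , _ , _ , inj₂ (i , _ , j' , _ , _ , e))) = i , j' , e

  nodeOf-nonSuccessorWitnesses : ∀ {v} → NodeOf G v → NonSuccessorWitnesses R v
  nodeOf-nonSuccessorWitnesses nv with node-name nv
  ... | i , j , refl = nonSuccessorWitnesses i j

lemma3p11 : (Σ : Vocabulary) (r : PropName) → inj₂ r ∈ Σ → (m : ℕ) → (c : NameChoice Σ m) → (E : PathExpr) → ¬ Simple E → IdFree E → Over Σ E
    → ((∀ a b → ⟦ prop r ⟧ (G'disj Σ m c) a b → ⟦ E ⟧ (G'disj Σ m c) a b) ⊎ (∀ a b → ⟦ inv r ⟧ (G'disj Σ m c) a b → ⟦ E ⟧ (G'disj Σ m c) a b))
      × (∀ v → NodeOf (G'disj Σ m c) v → ∃[ y ] (⟦ E ⟧ (G'disj Σ m c) v y × ¬ ⟦ prop r ⟧ (G'disj Σ m c) v y))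
lemma3p11 Σ r rΣ m c E ¬s f o =
    Sum.map (λ h a b → h {a} {b}) (λ h a b → h {a} {b}) (⟦⟧-⊇-or-⊇˘ R⇒prop factorising f o)
  , λ v nv → ⟦⟧-leaves-R R⇒prop factorising ¬s f o (nodeOf-nonSuccessorWitnesses nv)
  where open G'disjProperties Σ r rΣ m c
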